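{- Let $P=(X,\prec)$ be a finite poset and let $t\ge k\ge1$ be integers. Then for every minimal element $x$ of $P$, $$\frac{\Omega(P,k)}{\Omega(P,t)}\ \le\ \frac{\Omega(P\smallsetminus x,k)}{\Omega(P\smallsetminus x,t)},$$ where $P\smallsetminus x$ is the subposet induced on $X-x$.
   Context: $\Omega(Q,t)$ is the number of maps $g$ from the ground set of $Q$ to $[t]$ with $g(u)\le g(v)$ whenever $u\prec v$ (equal to $1$ for the empty poset). -}

module Defs where

open import Data.Nat using (ℕ; zero; suc; _+_)
open import Data.Fin using (Fin; _≤_; punchIn)
open import Data.Vec.Functional using (Vector)
open import Data.List using (List; []; _∷_; map; concatMap; allFin; filter; length)
open import Relation.Nullary using (Dec; yes; no)
open import Relation.Unary using (Decidable)
open import Relation.Binary using (Rel)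
open import Level using (0ℓ)
import Relation.Binary as B
open import Data.Fin.Properties using (_≤?_)
open import Data.List.Relation.Unary.All using (All)
open import Data.List.Relation.Unary.All.Properties using () 
import Data.List.Relation.Unary.All as All

-- A finite poset on ground set Fin m, given by its strict order relation _≺_
-- (decidable, so that linear extensions / order-preserving maps can be counted).

allMaps : (m t : ℕ) → List (Vector (Fin t) m)
allMaps zero    t = (λ ()) ∷ []
allMaps (suc m) t =
  concatMap (λ a → map (λ g → λ { Fin.zero → a ; (Fin.suc i) → g i }) (allMaps m t))
            (allFin t)

OrderPreserving : {m t : ℕ} → Rel (Fin m) 0ℓ → Vector (Fin t) m → Set
OrderPreserving {m} _≺_ g = ∀ (u v : Fin m) → u ≺ v → g u ≤ g v

orderPreserving? : {m t : ℕ} (_≺_ : Rel (Fin m) 0ℓ) → B.Decidable _≺_ →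
                   Decidable (OrderPreserving {m} {t} _≺_)
orderPreserving? {m} _≺_ d g with All.all? (λ u → All.all? (λ v → check u v) (allFin m)) (allFin m)
  where
  check : ∀ u v → Dec (u ≺ v → g u ≤ g v)
  check u v with d u v | g u ≤? g v
  ... | _     | yes p = yes (λ _ → p)
  ... | no ¬q | no _  = yes (λ q → Data.Empty.⊥-elim (¬q q))
    where import Data.Empty
  ... | yes q | no ¬p = no (λ f → ¬p (f q))
... | yes a = yes (λ u v → All.lookup (All.lookup a (Data.List.Membership.Propositional.Properties.∈-allFin u))
                                      (Data.List.Membership.Propositional.Properties.∈-allFin v))
  where import Data.List.Membership.Propositional.Properties
... | no ¬a = no (λ f → ¬a (All.tabulate (λ {u} _ → All.tabulate (λ {v} _ → f u v))))

Ω : {m : ℕ} (_≺_ : Rel (Fin m) 0ℓ) → B.Decidable _≺_ → ℕ → ℕ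
Ω {m} _≺_ d t = length (filter (orderPreserving? {m} {t} _≺_ d) (allMaps m t))

-- The induced subposet P ∖ x on X - x, identified with Fin m via punchIn x.
delete : {m : ℕ} → Fin (suc m) → Rel (Fin (suc m)) 0ℓ → Rel (Fin m) 0ℓ
delete x _≺_ u v = punchIn x u ≺ punchIn x v

delete? : {m : ℕ} (x : Fin (suc m)) (_≺_ : Rel (Fin (suc m)) 0ℓ) → B.Decidable _≺_ →
          B.Decidable (delete x _≺_)
delete? x _≺_ d u v = d (punchIn x u) (punchIn x v)

Minimal : {m : ℕ} → Rel (Fin m) 0ℓ → Fin m → Set
Minimal {m} _≺_ x = ∀ (y : Fin m) → Relation.Nullary.¬ (y ≺ x)
  where import Relation.Nullary

{-# OPTIONS --safe #-}
-- Order the maps g : X → [t] pointwise; this is a distributive lattice and the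
-- order-preserving maps form a sublattice.  On it, "g < k everywhere" and "g x = 0" are both
-- down-sets, so by the four functions theorem of Ahlswede and Daykin (which on products of
-- chains follows by induction from the two-element chain)
--   #(g < k) · #(g x = 0) ≤ #(all) · #(g < k and g x = 0).
-- The four counts are Ω(P,k), Ω(P∖x,t), Ω(P,t) and Ω(P∖x,k); for the second and fourth, the maps
-- with g x = 0 restrict bijectively to P ∖ x because x is minimal.

module Submission where

open import Defs
open import Data.Nat using (ℕ; suc; _≤_; _*_)
open import Data.Fin using (Fin)
open import Relation.Binary using (Rel; Decidable; IsStrictPartialOrder)
open import Relation.Binary.PropositionalEquality using (_≡_)
open import Level using (0ℓ)

open import Data.Nat using (zero; _+_; _<_; _⊔_; _⊓_; z≤n; s≤s; s≤s⁻¹)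
open import Data.Nat.Properties
open import Data.Nat.Tactic.RingSolver using (solve-∀)
open import Data.Fin as Fin using (zero; suc; toℕ; punchIn; punchOut; inject≤)
open import Data.Fin.Properties using (toℕ-inject≤; punchIn-punchOut; all?) renaming (_≟_ to _≟ᶠ_)
open import Data.List using (List; []; _∷_; _++_; map; concatMap; tabulate; allFin; filter; length)
open import Data.Vec.Functional using (Vector; tail; insertAt) renaming (_∷_ to _◂_; [] to ⟨⟩)
open import Data.Vec.Functional.Properties using (∷-cong; insertAt-lookup; insertAt-punchIn)
open import Data.Product using (_×_; _,_; proj₁; proj₂)
open import Data.Product.Function.NonDependent.Propositional using (_×-⇔_)
import Data.Product as Product
open import Data.Empty using (⊥-elim)
open import Function using (_∘_; id; _⇔_; mk⇔; Equivalence)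
open import Relation.Nullary using (yes; no; ¬_)
open import Relation.Unary as U using (Pred; _∩_)
open import Relation.Unary.Properties using (_∩?_)
open import Relation.Binary using (_Preserves_⟶_; _Respects_)
open import Relation.Binary.PropositionalEquality
  using (_≢_; refl; sym; trans; cong; cong₂; subst; subst₂; _≗_; module ≡-Reasoning)
open import Algebra.Properties.Semiring.Sum +-*-semiring
  using (sum; sum-syntax; sum-cong-≗; ∑-comm; *-distribʳ-sum; sum-replicate-zero)

open Equivalence using (to; from)

-- (m ∸ n) * (m ∸ o) ≥ 0, stated without subtraction.
m*[n+o]≤m*m+n*o : ∀ {m n o} → n ≤ m → o ≤ m → m * (n + o) ≤ m * m + n * o
m*[n+o]≤m*m+n*o {n = n} {o} n≤m o≤m with m≤n⇒∃[o]m+o≡n n≤m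
... | r , refl = begin
  (n + r) * (n + o)                  ≡⟨ regroup n r o ⟩
  (n + r) * n + (n * o + r * o)      ≤⟨ +-monoʳ-≤ ((n + r) * n) (+-monoʳ-≤ (n * o) (*-monoʳ-≤ r o≤m)) ⟩
  (n + r) * n + (n * o + r * (n + r)) ≡⟨ complete n r o ⟩
  (n + r) * (n + r) + n * o          ∎
  where
  open ≤-Reasoning
  regroup : ∀ n r o → (n + r) * (n + o) ≡ (n + r) * n + (n * o + r * o)
  regroup = solve-∀
  complete : ∀ n r o → (n + r) * n + (n * o + r * (n + r)) ≡ (n + r) * (n + r) + n * o
  complete = solve-∀

m≤o⇒n≤o⇒m*n≤o*p⇒m+n≤p+o : ∀ {m n o p} → m ≤ o → n ≤ o → m * n ≤ o * p → m + n ≤ p + o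
m≤o⇒n≤o⇒m*n≤o*p⇒m+n≤p+o {o = zero} m≤0 n≤0 _ = ≤-trans (+-mono-≤ m≤0 n≤0) z≤n
m≤o⇒n≤o⇒m*n≤o*p⇒m+n≤p+o {m} {n} {o@(suc _)} {p} m≤o n≤o mn≤op = *-cancelˡ-≤ o (begin
  o * (m + n)    ≤⟨ m*[n+o]≤m*m+n*o m≤o n≤o ⟩
  o * o + m * n  ≤⟨ +-monoʳ-≤ (o * o) mn≤op ⟩
  o * o + o * p  ≡⟨ *-distribˡ-+ o o p ⟨
  o * (o + p)    ≡⟨ cong (o *_) (+-comm o p) ⟩
  o * (p + o)    ∎)
  where open ≤-Reasoning

fourFunctions₂ : ∀ {a₀ a₁ b₀ b₁ c₀ c₁ d₀ d₁} →
  a₀ * b₀ ≤ c₀ * d₀ → a₀ * b₁ ≤ c₁ * d₀ → a₁ * b₀ ≤ c₁ * d₀ → a₁ * b₁ ≤ c₁ * d₁ →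
  (a₀ + a₁) * (b₀ + b₁) ≤ (c₀ + c₁) * (d₀ + d₁)
fourFunctions₂ {a₀} {a₁} {b₀} {b₁} {c₀} {c₁} {d₀} {d₁} h₀₀ h₀₁ h₁₀ h₁₁ = begin
  (a₀ + a₁) * (b₀ + b₁)                    ≡⟨ expand a₀ a₁ b₀ b₁ ⟩
  a₀ * b₀ + a₁ * b₁ + (a₀ * b₁ + a₁ * b₀)
    ≤⟨ +-mono-≤ (+-mono-≤ h₀₀ h₁₁) (m≤o⇒n≤o⇒m*n≤o*p⇒m+n≤p+o h₀₁ h₁₀ cross) ⟩
  c₀ * d₀ + c₁ * d₁ + (c₀ * d₁ + c₁ * d₀)  ≡⟨ expand c₀ c₁ d₀ d₁ ⟨
  (c₀ + c₁) * (d₀ + d₁)                    ∎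
  where
  open ≤-Reasoning
  expand : ∀ a b c d → (a + b) * (c + d) ≡ a * c + b * d + (a * d + b * c)
  expand = solve-∀
  swap : ∀ a b c d → (a * d) * (b * c) ≡ (a * c) * (b * d)
  swap = solve-∀
  cross : (a₀ * b₁) * (a₁ * b₀) ≤ (c₁ * d₀) * (c₀ * d₁)
  cross = begin
    (a₀ * b₁) * (a₁ * b₀)  ≡⟨ swap a₀ a₁ b₀ b₁ ⟩
    (a₀ * b₀) * (a₁ * b₁)  ≤⟨ *-mono-≤ h₀₀ h₁₁ ⟩
    (c₀ * d₀) * (c₁ * d₁)  ≡⟨ *-comm (c₀ * d₀) (c₁ * d₁) ⟩
    (c₁ * d₁) * (c₀ * d₀)  ≡⟨ swap c₁ c₀ d₀ d₁ ⟩
    (c₁ * d₀) * (c₀ * d₁)  ∎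

sum-mono-≤ : ∀ {n} {f g : Vector ℕ n} → (∀ i → f i ≤ g i) → sum f ≤ sum g
sum-mono-≤ {zero}  _   = z≤n
sum-mono-≤ {suc n} f≤g = +-mono-≤ (f≤g zero) (sum-mono-≤ (f≤g ∘ suc))

sum-*-mono-≤ : ∀ {n} {f g : Vector ℕ n} {u v} → (∀ i → f i * u ≤ g i * v) → sum f * u ≤ sum g * v
sum-*-mono-≤ {f = f} {g} {u} {v} h = begin
  sum f * u              ≡⟨ *-distribʳ-sum u f ⟩
  ∑[ i < _ ] (f i * u)  ≤⟨ sum-mono-≤ h ⟩
  ∑[ i < _ ] (g i * v)  ≡⟨ *-distribʳ-sum v g ⟨
  sum g * v              ∎
  where open ≤-Reasoning

sum-zero : ∀ {n} {f : Vector ℕ n} → (∀ i → f i ≡ 0) → sum f ≡ 0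
sum-zero {n} f≡0 = trans (sum-cong-≗ f≡0) (sum-replicate-zero n)

private variable A B : Set

sumBy : (A → ℕ) → List A → ℕ
sumBy f []       = 0
sumBy f (a ∷ as) = f a + sumBy f as

sumBy-cong : ∀ {f g : A → ℕ} → f ≗ g → ∀ as → sumBy f as ≡ sumBy g as
sumBy-cong f≗g []       = refl
sumBy-cong f≗g (a ∷ as) = cong₂ _+_ (f≗g a) (sumBy-cong f≗g as)

sumBy-zero : ∀ {f : A → ℕ} → (∀ a → f a ≡ 0) → ∀ as → sumBy f as ≡ 0
sumBy-zero f≡0 []       = refl
sumBy-zero f≡0 (a ∷ as) = cong₂ _+_ (f≡0 a) (sumBy-zero f≡0 as)

sumBy-*-distribˡ : ∀ c (f : A → ℕ) as → sumBy (λ a → c * f a) as ≡ c * sumBy f as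
sumBy-*-distribˡ c f []       = sym (*-zeroʳ c)
sumBy-*-distribˡ c f (a ∷ as) =
  trans (cong (c * f a +_) (sumBy-*-distribˡ c f as)) (sym (*-distribˡ-+ c (f a) _))

sumBy-++ : ∀ (f : A → ℕ) as bs → sumBy f (as ++ bs) ≡ sumBy f as + sumBy f bs
sumBy-++ f []       bs = refl
sumBy-++ f (a ∷ as) bs = trans (cong (f a +_) (sumBy-++ f as bs)) (sym (+-assoc (f a) _ _))

sumBy-tabulate : ∀ {n} (f : A → ℕ) (g : Fin n → A) → sumBy f (tabulate g) ≡ sum (f ∘ g)
sumBy-tabulate {n = zero}  f g = refl
sumBy-tabulate {n = suc n} f g = cong (f (g zero) +_) (sumBy-tabulate f (g ∘ suc))

sumBy-map : ∀ (f : B → ℕ) (h : A → B) as → sumBy f (map h as) ≡ sumBy (f ∘ h) as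
sumBy-map f h []       = refl
sumBy-map f h (a ∷ as) = cong (f (h a) +_) (sumBy-map f h as)

sumBy-concatMap : ∀ (f : B → ℕ) (h : A → List B) as →
                  sumBy f (concatMap h as) ≡ sumBy (sumBy f ∘ h) as
sumBy-concatMap f h []       = refl
sumBy-concatMap f h (a ∷ as) =
  trans (sumBy-++ f (h a) (concatMap h as)) (cong (sumBy f (h a) +_) (sumBy-concatMap f h as))

sumBy-allFin : ∀ {n} (f : Fin n → ℕ) → sumBy f (allFin n) ≡ sum f
sumBy-allFin f = sumBy-tabulate f id

-- The chain [t] as a lattice

infixr 6 _⊔ᶠ_ _∨_
infixr 7 _⊓ᶠ_ _∧_

_⊔ᶠ_ : ∀ {t} → Fin t → Fin t → Fin t
zero  ⊔ᶠ j     = j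
suc i ⊔ᶠ zero  = suc i
suc i ⊔ᶠ suc j = suc (i ⊔ᶠ j)

_⊓ᶠ_ : ∀ {t} → Fin t → Fin t → Fin t
zero  ⊓ᶠ j     = zero
suc i ⊓ᶠ zero  = zero
suc i ⊓ᶠ suc j = suc (i ⊓ᶠ j)

toℕ-⊔ᶠ : ∀ {t} (i j : Fin t) → toℕ (i ⊔ᶠ j) ≡ toℕ i ⊔ toℕ j
toℕ-⊔ᶠ zero    j       = refl
toℕ-⊔ᶠ (suc i) zero    = refl
toℕ-⊔ᶠ (suc i) (suc j) = cong suc (toℕ-⊔ᶠ i j)

toℕ-⊓ᶠ : ∀ {t} (i j : Fin t) → toℕ (i ⊓ᶠ j) ≡ toℕ i ⊓ toℕ j
toℕ-⊓ᶠ zero    j       = refl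
toℕ-⊓ᶠ (suc i) zero    = refl
toℕ-⊓ᶠ (suc i) (suc j) = cong suc (toℕ-⊓ᶠ i j)

-- [t + 1] is 0 below a copy of [t]; the copy enters fourFunctions₂ as a single point.
fourFunctions-chain : ∀ {t} (α β γ δ : Vector ℕ t) →
  (∀ i j → α i * β j ≤ γ (i ⊔ᶠ j) * δ (i ⊓ᶠ j)) → sum α * sum β ≤ sum γ * sum δ
fourFunctions-chain {zero}  _ _ _ _ _ = z≤n
fourFunctions-chain {suc t} α β γ δ h =
  fourFunctions₂ {α zero} {sum (tail α)} {β zero} {sum (tail β)} {γ zero} {sum (tail γ)} {δ zero} {sum (tail δ)}
    (h zero zero) bottom×rest rest×bottom
    (fourFunctions-chain (tail α) (tail β) (tail γ) (tail δ) λ i j → h (suc i) (suc j))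
  where
  open ≤-Reasoning
  bottom×rest : α zero * sum (tail β) ≤ sum (tail γ) * δ zero
  bottom×rest = begin
    α zero * sum (tail β)  ≡⟨ *-comm (α zero) (sum (tail β)) ⟩
    sum (tail β) * α zero  ≤⟨ sum-*-mono-≤ (λ j →
                                subst (_≤ γ (suc j) * δ zero) (*-comm (α zero) (β (suc j))) (h zero (suc j))) ⟩
    sum (tail γ) * δ zero  ∎
  rest×bottom : sum (tail α) * β zero ≤ sum (tail γ) * δ zero
  rest×bottom = sum-*-mono-≤ λ i → h (suc i) zero

𝟙 : {P : Pred A 0ℓ} → U.Decidable P → A → ℕ
𝟙 P? a with P? a
... | yes _ = 1
... | no  _ = 0

module _ {A B C D : Set} {P : Pred A 0ℓ} {Q : Pred B 0ℓ} {R : Pred C 0ℓ} {S : Pred D 0ℓ}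
         (P? : U.Decidable P) (Q? : U.Decidable Q) (R? : U.Decidable R) (S? : U.Decidable S)
         {a : A} {b : B} {c : C} {d : D} where

  𝟙-*-mono-≤ : (P a → Q b → R c × S d) → 𝟙 P? a * 𝟙 Q? b ≤ 𝟙 R? c * 𝟙 S? d
  𝟙-*-mono-≤ implies with P? a | Q? b
  ... | no _  | _     = z≤n
  ... | yes _ | no _  = z≤n
  ... | yes p | yes q with R? c | S? d
  ...   | yes _ | yes _ = ≤-refl
  ...   | no ¬r | _     = ⊥-elim (¬r (proj₁ (implies p q)))
  ...   | yes _ | no ¬s = ⊥-elim (¬s (proj₂ (implies p q)))

module _ {A B : Set} {P : Pred A 0ℓ} {Q : Pred B 0ℓ} (P? : U.Decidable P) (Q? : U.Decidable Q)
         {a : A} {b : B} where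

  𝟙-cong : P a ⇔ Q b → 𝟙 P? a ≡ 𝟙 Q? b
  𝟙-cong P⇔Q with P? a | Q? b
  ... | yes _ | yes _ = refl
  ... | no  _ | no  _ = refl
  ... | yes p | no ¬q = ⊥-elim (¬q (to P⇔Q p))
  ... | no ¬p | yes q = ⊥-elim (¬p (from P⇔Q q))

module _ {A B C : Set} {P : Pred A 0ℓ} {Q : Pred B 0ℓ} {R : Pred C 0ℓ}
         (P? : U.Decidable P) (Q? : U.Decidable Q) (R? : U.Decidable R) {a : A} {b : B} {c : C} where

  𝟙-× : P a ⇔ (Q b × R c) → 𝟙 P? a ≡ 𝟙 Q? b * 𝟙 R? c
  𝟙-× P⇔Q×R with P? a | Q? b | R? c
  ... | yes _ | yes _ | yes _ = refl
  ... | no  _ | no  _ | _     = refl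
  ... | no  _ | yes _ | no  _ = refl
  ... | no ¬p | yes q | yes r = ⊥-elim (¬p (from P⇔Q×R (q , r)))
  ... | yes p | no ¬q | _     = ⊥-elim (¬q (proj₁ (to P⇔Q×R p)))
  ... | yes p | yes _ | no ¬r = ⊥-elim (¬r (proj₂ (to P⇔Q×R p)))

module _ {A : Set} {P : Pred A 0ℓ} (P? : U.Decidable P) {a : A} where

  𝟙-yes : P a → 𝟙 P? a ≡ 1
  𝟙-yes p with P? a
  ... | yes _ = refl
  ... | no ¬p = ⊥-elim (¬p p)

  𝟙-no : ¬ P a → 𝟙 P? a ≡ 0
  𝟙-no ¬p with P? a
  ... | yes p = ⊥-elim (¬p p)
  ... | no  _ = refl

𝟙-∩ : ∀ {P Q : Pred A 0ℓ} (P? : U.Decidable P) (Q? : U.Decidable Q) a →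
      𝟙 (P? ∩? Q?) a ≡ 𝟙 P? a * 𝟙 Q? a
𝟙-∩ P? Q? a = 𝟙-× (P? ∩? Q?) P? Q? (mk⇔ id id)

length-filter≡sumBy-𝟙 : ∀ {P : Pred A 0ℓ} (P? : U.Decidable P) as →
                         length (filter P? as) ≡ sumBy (𝟙 P?) as
length-filter≡sumBy-𝟙 P? []       = refl
length-filter≡sumBy-𝟙 P? (a ∷ as) with P? a
... | yes _ = cong suc (length-filter≡sumBy-𝟙 P? as)
... | no  _ = length-filter≡sumBy-𝟙 P? as

-- Sums over all maps X → [t]

module _ {n t : ℕ} where

  𝟙-preserves-≗ : {P : Pred (Vector (Fin t) n) 0ℓ} (P? : U.Decidable P) →
                  P Respects _≗_ → 𝟙 P? Preserves _≗_ ⟶ _≡_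
  𝟙-preserves-≗ P? resp g≗h = 𝟙-cong P? P? (mk⇔ (resp g≗h) (resp (sym ∘ g≗h)))

  ∩-respects-≗ : {P Q : Pred (Vector (Fin t) n) 0ℓ} →
                 P Respects _≗_ → Q Respects _≗_ → (P ∩ Q) Respects _≗_
  ∩-respects-≗ P-resp Q-resp g≗h = Product.map (P-resp g≗h) (Q-resp g≗h)

-- allMaps builds its vectors with its own pattern lambda, which is only pointwise equal to
-- a ◂ g; without function extensionality, summands must therefore respect _≗_.
sumBy-allMaps-zero : ∀ {t} (F : Vector (Fin t) 0 → ℕ) → F Preserves _≗_ ⟶ _≡_ →
                     ∀ g → sumBy F (allMaps 0 t) ≡ F g
sumBy-allMaps-zero F F-ext g = trans (+-identityʳ _) (F-ext λ ())

sumBy-allMaps-◂ : ∀ {n t} (F : Vector (Fin t) (suc n) → ℕ) → F Preserves _≗_ ⟶ _≡_ →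
                  sumBy F (allMaps (suc n) t) ≡ ∑[ a < t ] sumBy (λ g → F (a ◂ g)) (allMaps n t)
sumBy-allMaps-◂ {n} {t} F F-ext =
  trans (sumBy-concatMap F _ (allFin t))
  (trans (sumBy-allFin {t} _)
  (sum-cong-≗ {t} λ a → trans (sumBy-map F _ (allMaps n t))
                          (sumBy-cong (λ g → F-ext λ { zero → refl ; (suc _) → refl }) (allMaps n t))))

insertAt-cong : ∀ {n} {g h : Vector A n} (x : Fin (suc n)) (a : A) →
                g ≗ h → insertAt g x a ≗ insertAt h x a
insertAt-cong zero    a g≗h zero    = refl
insertAt-cong zero    a g≗h (suc i) = g≗h i
insertAt-cong {n = suc n} (suc x) a g≗h zero    = g≗h zero
insertAt-cong {n = suc n} (suc x) a g≗h (suc i) = insertAt-cong x a (g≗h ∘ suc) i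

sumBy-allMaps-insertAt : ∀ {n t} (x : Fin (suc n)) (F : Vector (Fin t) (suc n) → ℕ) →
  F Preserves _≗_ ⟶ _≡_ →
  sumBy F (allMaps (suc n) t) ≡ ∑[ a < t ] sumBy (λ g → F (insertAt g x a)) (allMaps n t)
sumBy-allMaps-insertAt {n} {t} zero F F-ext =
  trans (sumBy-allMaps-◂ F F-ext)
        (sum-cong-≗ {t} λ a → sumBy-cong (λ g → F-ext λ { zero → refl ; (suc _) → refl }) (allMaps n t))
sumBy-allMaps-insertAt {suc n} {t} (suc x) F F-ext = begin
  sumBy F (allMaps (suc (suc n)) t)
    ≡⟨ sumBy-allMaps-◂ F F-ext ⟩
  ∑[ b < t ] sumBy (λ h → F (b ◂ h)) (allMaps (suc n) t)
    ≡⟨ sum-cong-≗ {t} (λ b → sumBy-allMaps-insertAt x (F ∘ (b ◂_)) (F-ext ∘ ∷-cong refl)) ⟩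
  ∑[ b < t ] ∑[ a < t ] sumBy (λ g → F (b ◂ insertAt g x a)) (allMaps n t)
    ≡⟨ ∑-comm (λ b a → sumBy (λ g → F (b ◂ insertAt g x a)) (allMaps n t)) ⟩
  ∑[ a < t ] ∑[ b < t ] sumBy (λ g → F (b ◂ insertAt g x a)) (allMaps n t)
    ≡⟨ sum-cong-≗ {t} (λ a → sum-cong-≗ {t} λ b →
         sumBy-cong (λ g → F-ext λ { zero → refl ; (suc _) → refl }) (allMaps n t)) ⟩
  ∑[ a < t ] ∑[ b < t ] sumBy (λ g → F (insertAt (b ◂ g) (suc x) a)) (allMaps n t)
    ≡⟨ sum-cong-≗ {t} (λ a → sumBy-allMaps-◂ _ (F-ext ∘ insertAt-cong (suc x) a)) ⟨
  ∑[ a < t ] sumBy (λ g → F (insertAt g (suc x) a)) (allMaps (suc n) t)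
    ∎
  where open ≡-Reasoning

_∨_ : ∀ {n t} → Vector (Fin t) n → Vector (Fin t) n → Vector (Fin t) n
(g ∨ h) i = g i ⊔ᶠ h i

_∧_ : ∀ {n t} → Vector (Fin t) n → Vector (Fin t) n → Vector (Fin t) n
(g ∧ h) i = g i ⊓ᶠ h i

fourFunctions : ∀ n {t} (α β γ δ : Vector (Fin t) n → ℕ) →
  α Preserves _≗_ ⟶ _≡_ → β Preserves _≗_ ⟶ _≡_ →
  γ Preserves _≗_ ⟶ _≡_ → δ Preserves _≗_ ⟶ _≡_ →
  (∀ g h → α g * β h ≤ γ (g ∨ h) * δ (g ∧ h)) →
  sumBy α (allMaps n t) * sumBy β (allMaps n t) ≤ sumBy γ (allMaps n t) * sumBy δ (allMaps n t)
fourFunctions zero α β γ δ α-ext β-ext γ-ext δ-ext h =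
  subst₂ _≤_ (sym (cong₂ _*_ (sumBy-allMaps-zero α α-ext ⟨⟩) (sumBy-allMaps-zero β β-ext ⟨⟩)))
             (sym (cong₂ _*_ (sumBy-allMaps-zero γ γ-ext _) (sumBy-allMaps-zero δ δ-ext _)))
             (h ⟨⟩ ⟨⟩)
fourFunctions (suc n) {t} α β γ δ α-ext β-ext γ-ext δ-ext h =
  subst₂ _≤_ (sym (cong₂ _*_ (sumBy-allMaps-◂ α α-ext) (sumBy-allMaps-◂ β β-ext)))
             (sym (cong₂ _*_ (sumBy-allMaps-◂ γ γ-ext) (sumBy-allMaps-◂ δ δ-ext)))
             (fourFunctions-chain _ _ _ _ λ a b →
                fourFunctions n (λ g → α (a ◂ g)) (λ g → β (b ◂ g))
                                (λ g → γ (a ⊔ᶠ b ◂ g)) (λ g → δ (a ⊓ᶠ b ◂ g))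
                  (α-ext ∘ ∷-cong refl) (β-ext ∘ ∷-cong refl) (γ-ext ∘ ∷-cong refl) (δ-ext ∘ ∷-cong refl)
                  λ g h′ → subst₂ (λ u v → α (a ◂ g) * β (b ◂ h′) ≤ u * v)
                                  (γ-ext λ { zero → refl ; (suc _) → refl })
                                  (δ-ext λ { zero → refl ; (suc _) → refl })
                                  (h (a ◂ g) (b ◂ h′)))

below? : ∀ {t} k → U.Decidable (λ (a : Fin t) → toℕ a < k)
below? k a = toℕ a <? k

Bounded : ∀ {n t} → ℕ → Pred (Vector (Fin t) n) 0ℓ
Bounded k g = ∀ i → toℕ (g i) < k

bounded? : ∀ {n t} k → U.Decidable (Bounded {n} {t} k)
bounded? k g = all? λ i → below? k (g i)

Bounded-respects-≗ : ∀ {n t} k → Bounded {n} {t} k Respects _≗_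
Bounded-respects-≗ k g≗h g<k i = subst (λ a → toℕ a < k) (g≗h i) (g<k i)

Bounded-◂ : ∀ {n t} k (a : Fin t) (g : Vector (Fin t) n) → Bounded k (a ◂ g) ⇔ (toℕ a < k × Bounded k g)
Bounded-◂ k a g = mk⇔ (λ a◂g<k → a◂g<k zero , a◂g<k ∘ suc)
                      (λ { (a<k , g<k) zero → a<k ; (a<k , g<k) (suc i) → g<k i })

Bounded-∧ : ∀ {n t k} {g h : Vector (Fin t) n} → Bounded k g → Bounded k (g ∧ h)
Bounded-∧ {k = k} {g} {h} g<k i = subst (_< k) (sym (toℕ-⊓ᶠ (g i) (h i))) (m<n⇒m⊓o<n (toℕ (h i)) (g<k i))

widen : ∀ {n k t} → k ≤ t → Vector (Fin k) n → Vector (Fin t) n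
widen k≤t g i = inject≤ (g i) k≤t

widen-cong : ∀ {n k t} (k≤t : k ≤ t) {g h : Vector (Fin k) n} → g ≗ h → widen k≤t g ≗ widen k≤t h
widen-cong k≤t g≗h i = cong (λ a → inject≤ a k≤t) (g≗h i)

∑-𝟙-below : ∀ {k t} (k≤t : k ≤ t) (φ : Vector ℕ t) →
            ∑[ a < t ] (𝟙 (below? k) a * φ a) ≡ ∑[ a < k ] φ (inject≤ a k≤t)
∑-𝟙-below z≤n φ = sum-zero λ a → cong (_* φ a) (𝟙-no (below? 0) {a} λ ())
∑-𝟙-below {suc k} {suc t} (s≤s k≤t) φ =
  cong₂ _+_ (trans (cong (_* φ zero) (𝟙-yes (below? {suc t} (suc k)) (s≤s z≤n))) (+-identityʳ (φ zero)))
            (trans (sum-cong-≗ {t} λ a →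
                      cong (_* φ (suc a)) (𝟙-cong (below? (suc k)) (below? k) (mk⇔ s≤s⁻¹ s≤s)))
                   (∑-𝟙-below k≤t (tail φ)))

𝟙-bounded-*-preserves-≗ : ∀ {n t} k {F : Vector (Fin t) n → ℕ} → F Preserves _≗_ ⟶ _≡_ →
                          (λ g → 𝟙 (bounded? k) g * F g) Preserves _≗_ ⟶ _≡_
𝟙-bounded-*-preserves-≗ k F-ext g≗h =
  cong₂ _*_ (𝟙-preserves-≗ (bounded? k) (Bounded-respects-≗ k) g≗h) (F-ext g≗h)

sumBy-bounded : ∀ n {k t} (k≤t : k ≤ t) (F : Vector (Fin t) n → ℕ) → F Preserves _≗_ ⟶ _≡_ →
  sumBy (λ g → 𝟙 (bounded? k) g * F g) (allMaps n t) ≡ sumBy (F ∘ widen k≤t) (allMaps n k)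
sumBy-bounded zero {k} {t} k≤t F F-ext = begin
  sumBy (λ g → 𝟙 (bounded? k) g * F g) (allMaps 0 t)
    ≡⟨ sumBy-allMaps-zero _ (𝟙-bounded-*-preserves-≗ k F-ext) w ⟩
  𝟙 (bounded? k) w * F w
    ≡⟨ cong (_* F w) (𝟙-yes (bounded? k) {w} λ ()) ⟩
  1 * F w
    ≡⟨ *-identityˡ (F w) ⟩
  F w
    ≡⟨ sumBy-allMaps-zero (F ∘ widen k≤t) (F-ext ∘ widen-cong k≤t) ⟨⟩ ⟨
  sumBy (F ∘ widen k≤t) (allMaps 0 k) ∎
  where
  open ≡-Reasoning
  w = widen k≤t ⟨⟩
sumBy-bounded (suc n) {k} {t} k≤t F F-ext = begin
  sumBy (λ g → 𝟙 (bounded? k) g * F g) (allMaps (suc n) t)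
    ≡⟨ sumBy-allMaps-◂ _ (𝟙-bounded-*-preserves-≗ k F-ext) ⟩
  ∑[ a < t ] sumBy (λ g → 𝟙 (bounded? k) (a ◂ g) * F (a ◂ g)) (allMaps n t)
    ≡⟨ sum-cong-≗ {t} column ⟩
  ∑[ a < t ] (𝟙 (below? k) a * sumBy (λ g → F (a ◂ widen k≤t g)) (allMaps n k))
    ≡⟨ ∑-𝟙-below k≤t (λ a → sumBy (λ g → F (a ◂ widen k≤t g)) (allMaps n k)) ⟩
  ∑[ a < k ] sumBy (λ g → F (inject≤ a k≤t ◂ widen k≤t g)) (allMaps n k)
    ≡⟨ sum-cong-≗ {k} (λ a → sumBy-cong (λ g → F-ext λ { zero → refl ; (suc _) → refl }) (allMaps n k)) ⟩
  ∑[ a < k ] sumBy (λ g → F (widen k≤t (a ◂ g))) (allMaps n k)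
    ≡⟨ sumBy-allMaps-◂ (F ∘ widen k≤t) (F-ext ∘ widen-cong k≤t) ⟨
  sumBy (F ∘ widen k≤t) (allMaps (suc n) k) ∎
  where
  open ≡-Reasoning
  column : ∀ a → sumBy (λ g → 𝟙 (bounded? k) (a ◂ g) * F (a ◂ g)) (allMaps n t)
               ≡ 𝟙 (below? k) a * sumBy (λ g → F (a ◂ widen k≤t g)) (allMaps n k)
  column a = begin
    sumBy (λ g → 𝟙 (bounded? k) (a ◂ g) * F (a ◂ g)) (allMaps n t)
      ≡⟨ sumBy-cong (λ g → trans (cong (_* F (a ◂ g)) (𝟙-× (bounded? k) (below? k) (bounded? k)
                                                          (Bounded-◂ k a g)))
                                 (*-assoc (𝟙 (below? k) a) _ _)) (allMaps n t) ⟩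
    sumBy (λ g → 𝟙 (below? k) a * (𝟙 (bounded? k) g * F (a ◂ g))) (allMaps n t)
      ≡⟨ sumBy-*-distribˡ (𝟙 (below? k) a) _ (allMaps n t) ⟩
    𝟙 (below? k) a * sumBy (λ g → 𝟙 (bounded? k) g * F (a ◂ g)) (allMaps n t)
      ≡⟨ cong (𝟙 (below? k) a *_) (sumBy-bounded n k≤t (F ∘ (a ◂_)) (F-ext ∘ ∷-cong refl)) ⟩
    𝟙 (below? k) a * sumBy (λ g → F (a ◂ widen k≤t g)) (allMaps n k) ∎

sumBy-bounded-∩ : ∀ {n k t} (k≤t : k ≤ t) {P : Pred (Vector (Fin t) n) 0ℓ} {Q : Pred (Vector (Fin k) n) 0ℓ}
  (P? : U.Decidable P) (Q? : U.Decidable Q) → P Respects _≗_ → (∀ g → P (widen k≤t g) ⇔ Q g) →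
  sumBy (𝟙 (bounded? k ∩? P?)) (allMaps n t) ≡ sumBy (𝟙 Q?) (allMaps n k)
sumBy-bounded-∩ {n} {k} {t} k≤t P? Q? P-resp P⇔Q =
  trans (sumBy-cong (𝟙-∩ (bounded? k) P?) (allMaps n t))
  (trans (sumBy-bounded n k≤t (𝟙 P?) (𝟙-preserves-≗ P? P-resp))
         (sumBy-cong (λ g → 𝟙-cong P? Q? (P⇔Q g)) (allMaps n k)))

-- Order-preserving maps

module _ {n t : ℕ} {R : Rel (Fin n) 0ℓ} where

  OrderPreserving-respects-≗ : OrderPreserving {n} {t} R Respects _≗_
  OrderPreserving-respects-≗ g≗h g-op u v uRv = subst₂ Fin._≤_ (g≗h u) (g≗h v) (g-op u v uRv)

  OrderPreserving-∨ : {g h : Vector (Fin t) n} →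
    OrderPreserving R g → OrderPreserving R h → OrderPreserving R (g ∨ h)
  OrderPreserving-∨ {g} {h} g-op h-op u v uRv =
    subst₂ _≤_ (sym (toℕ-⊔ᶠ (g u) (h u))) (sym (toℕ-⊔ᶠ (g v) (h v)))
      (⊔-mono-≤ (g-op u v uRv) (h-op u v uRv))

  OrderPreserving-∧ : {g h : Vector (Fin t) n} →
    OrderPreserving R g → OrderPreserving R h → OrderPreserving R (g ∧ h)
  OrderPreserving-∧ {g} {h} g-op h-op u v uRv =
    subst₂ _≤_ (sym (toℕ-⊓ᶠ (g u) (h u))) (sym (toℕ-⊓ᶠ (g v) (h v)))
      (⊓-mono-≤ (g-op u v uRv) (h-op u v uRv))

  OrderPreserving-widen : ∀ {k} (k≤t : k ≤ t) (g : Vector (Fin k) n) →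
                          OrderPreserving R (widen k≤t g) ⇔ OrderPreserving R g
  OrderPreserving-widen k≤t g = mk⇔
    (λ g-op u v uRv → subst₂ _≤_ (toℕ-inject≤ (g u) k≤t) (toℕ-inject≤ (g v) k≤t) (g-op u v uRv))
    (λ g-op u v uRv → subst₂ _≤_ (sym (toℕ-inject≤ (g u) k≤t)) (sym (toℕ-inject≤ (g v) k≤t))
                                 (g-op u v uRv))

AtZero : ∀ {n t} → Fin n → Pred (Vector (Fin t) n) 0ℓ
AtZero x g = toℕ (g x) ≡ 0

atZero? : ∀ {n t} (x : Fin n) → U.Decidable (AtZero {n} {t} x)
atZero? x g = toℕ (g x) ≟ 0

module _ {n : ℕ} (x : Fin n) where

  AtZero-respects-≗ : ∀ {t} → AtZero {n} {t} x Respects _≗_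
  AtZero-respects-≗ g≗h gx≡0 = trans (cong toℕ (sym (g≗h x))) gx≡0

  AtZero-∧ : ∀ {t} {g h : Vector (Fin t) n} → AtZero x h → AtZero x (g ∧ h)
  AtZero-∧ {g = g} {h} hx≡0 =
    trans (toℕ-⊓ᶠ (g x) (h x)) (n≤0⇒n≡0 (≤-trans (m⊓n≤n _ _) (≤-reflexive hx≡0)))

  AtZero-widen : ∀ {k t} (k≤t : k ≤ t) (g : Vector (Fin k) n) → AtZero x (widen k≤t g) ⇔ AtZero x g
  AtZero-widen k≤t g = mk⇔ (trans (sym (toℕ-inject≤ (g x) k≤t))) (trans (toℕ-inject≤ (g x) k≤t))

Ω≡sumBy-bounded : ∀ {n k t} (R : Rel (Fin n) 0ℓ) (R? : Decidable R) → k ≤ t →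
  Ω R R? k ≡ sumBy (𝟙 (bounded? k ∩? orderPreserving? R R?)) (allMaps n t)
Ω≡sumBy-bounded {n} {k} R R? k≤t =
  trans (length-filter≡sumBy-𝟙 (orderPreserving? R R?) (allMaps n k))
        (sym (sumBy-bounded-∩ k≤t (orderPreserving? R R?) (orderPreserving? R R?)
                              OrderPreserving-respects-≗ (OrderPreserving-widen k≤t)))

bounded-atZero-correlated : ∀ {n t} (R : Rel (Fin n) 0ℓ) (R? : Decidable R) (x : Fin n) k →
  let op? = orderPreserving? {t = t} R R? in
  sumBy (𝟙 (bounded? k ∩? op?)) (allMaps n t) * sumBy (𝟙 (atZero? x ∩? op?)) (allMaps n t)
    ≤ sumBy (𝟙 op?) (allMaps n t) * sumBy (𝟙 (bounded? k ∩? (atZero? x ∩? op?))) (allMaps n t)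
bounded-atZero-correlated {n} {t} R R? x k =
  fourFunctions n (𝟙 B?) (𝟙 Z?) (𝟙 op?) (𝟙 BZ?)
    (𝟙-preserves-≗ B? (∩-respects-≗ (Bounded-respects-≗ k) op-resp)) (𝟙-preserves-≗ Z? Z-resp)
    (𝟙-preserves-≗ op? op-resp) (𝟙-preserves-≗ BZ? (∩-respects-≗ (Bounded-respects-≗ k) Z-resp))
    λ g h → 𝟙-*-mono-≤ B? Z? op? BZ? λ (g<k , g-op) (hx≡0 , h-op) →
      OrderPreserving-∨ g-op h-op , Bounded-∧ g<k , AtZero-∧ x {g = g} {h} hx≡0 , OrderPreserving-∧ g-op h-op
  where
  op? = orderPreserving? {t = t} R R?
  Z? = atZero? x ∩? op?
  B? = bounded? k ∩? op?
  BZ? = bounded? k ∩? Z?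
  op-resp = OrderPreserving-respects-≗
  Z-resp = ∩-respects-≗ (AtZero-respects-≗ x) op-resp

insertAt-punchOut : ∀ {n} (g : Vector A n) (x : Fin (suc n)) a {u} (x≢u : x ≢ u) →
                    insertAt g x a u ≡ g (punchOut x≢u)
insertAt-punchOut g x a x≢u = trans (cong (insertAt g x a) (sym (punchIn-punchOut x≢u))) (insertAt-punchIn g x a _)

module _ {m : ℕ} (R : Rel (Fin (suc m)) 0ℓ) (x : Fin (suc m)) where

  OrderPreserving-insertAt⁻ : ∀ {t} {h : Vector (Fin t) m} {a} →
    OrderPreserving R (insertAt h x a) → OrderPreserving (delete x R) h
  OrderPreserving-insertAt⁻ {h = h} {a} op u v uRv =
    subst₂ Fin._≤_ (insertAt-punchIn h x a u) (insertAt-punchIn h x a v) (op (punchIn x u) (punchIn x v) uRv)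

  OrderPreserving-insertAt-zero : ∀ {s} {h : Vector (Fin (suc s)) m} → Minimal R x →
    OrderPreserving (delete x R) h → OrderPreserving R (insertAt h x zero)
  OrderPreserving-insertAt-zero {h = h} x-min h-op u v uRv with x ≟ᶠ u | x ≟ᶠ v
  ... | yes refl | _        = subst (Fin._≤ insertAt h x zero v) (sym (insertAt-lookup h x zero)) z≤n
  ... | no _     | yes refl = ⊥-elim (x-min u uRv)
  ... | no x≢u   | no x≢v   =
    subst₂ Fin._≤_ (sym (insertAt-punchOut h x zero x≢u)) (sym (insertAt-punchOut h x zero x≢v))
      (h-op _ _ (subst₂ R (sym (punchIn-punchOut x≢u)) (sym (punchIn-punchOut x≢v)) uRv))

  -- As x is minimal, g ↦ insertAt g x 0 identifies the (P ∖ x)-maps with the P-maps sending x to 0.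
  Ω-delete≡sumBy-atZero : (R? : Decidable R) → Minimal R x → ∀ s →
    Ω (delete x R) (delete? x R R?) (suc s)
      ≡ sumBy (𝟙 (atZero? x ∩? orderPreserving? R R?)) (allMaps (suc m) (suc s))
  Ω-delete≡sumBy-atZero R? x-min s = begin
    Ω (delete x R) (delete? x R R?) (suc s)
      ≡⟨ length-filter≡sumBy-𝟙 op∖x? (allMaps m (suc s)) ⟩
    sumBy (𝟙 op∖x?) (allMaps m (suc s))
      ≡⟨ +-identityʳ _ ⟨
    sumBy (𝟙 op∖x?) (allMaps m (suc s)) + 0
      ≡⟨ cong₂ _+_ (sumBy-cong bottom (allMaps m (suc s)))
                   (sym (sum-zero {s} λ a → sumBy-zero (not-bottom a) (allMaps m (suc s)))) ⟩
    ∑[ a < suc s ] sumBy (λ h → 𝟙 Z? (insertAt h x a)) (allMaps m (suc s))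
      ≡⟨ sumBy-allMaps-insertAt x (𝟙 Z?)
           (𝟙-preserves-≗ Z? (∩-respects-≗ (AtZero-respects-≗ x) OrderPreserving-respects-≗)) ⟨
    sumBy (𝟙 Z?) (allMaps (suc m) (suc s)) ∎
    where
    open ≡-Reasoning
    op∖x? = orderPreserving? (delete x R) (delete? x R R?)
    Z? = atZero? x ∩? orderPreserving? R R?
    bottom : ∀ h → 𝟙 op∖x? h ≡ 𝟙 Z? (insertAt h x zero)
    bottom h = 𝟙-cong op∖x? Z?
      (mk⇔ (λ h-op → cong toℕ (insertAt-lookup h x zero) , OrderPreserving-insertAt-zero x-min h-op)
           (OrderPreserving-insertAt⁻ ∘ proj₂))
    not-bottom : ∀ a h → 𝟙 Z? (insertAt h x (suc a)) ≡ 0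
    not-bottom a h = 𝟙-no Z? λ (x↦0 , _) → 0≢1+n (trans (sym x↦0) (cong toℕ (insertAt-lookup h x (suc a))))

  Ω-delete≡sumBy-bounded-atZero : (R? : Decidable R) → Minimal R x → ∀ {k t} → k ≤ t →
    Ω (delete x R) (delete? x R R?) (suc k)
      ≡ sumBy (𝟙 (bounded? (suc k) ∩? (atZero? x ∩? orderPreserving? R R?))) (allMaps (suc m) (suc t))
  Ω-delete≡sumBy-bounded-atZero R? x-min k≤t =
    trans (Ω-delete≡sumBy-atZero R? x-min _)
      (sym (sumBy-bounded-∩ (s≤s k≤t) _ _ (∩-respects-≗ (AtZero-respects-≗ x) OrderPreserving-respects-≗)
                             λ g → AtZero-widen x (s≤s k≤t) g ×-⇔ OrderPreserving-widen (s≤s k≤t) g))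

lemma4p16 : (m : ℕ) (_≺_ : Rel (Fin (suc m)) 0ℓ) (dec : Decidable _≺_) →
    IsStrictPartialOrder _≡_ _≺_ →
    (k t : ℕ) → 1 ≤ k → k ≤ t →
    (x : Fin (suc m)) → Minimal _≺_ x →
    Ω _≺_ dec k * Ω (delete x _≺_) (delete? x _≺_ dec) t
      ≤ Ω (delete x _≺_) (delete? x _≺_ dec) k * Ω _≺_ dec t
lemma4p16 m _≺_ _≺?_ _ (suc k) (suc t) (s≤s z≤n) k≤t x x-min = begin
  Ω _≺_ _≺?_ (suc k) * Ω P∖x P∖x? (suc t)
    ≡⟨ cong₂ _*_ (Ω≡sumBy-bounded _≺_ _≺?_ k≤t) (Ω-delete≡sumBy-atZero _≺_ x _≺?_ x-min t) ⟩
  sumBy (𝟙 (bounded? (suc k) ∩? op?)) maps * sumBy (𝟙 (atZero? x ∩? op?)) maps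
    ≤⟨ bounded-atZero-correlated {t = suc t} _≺_ _≺?_ x (suc k) ⟩
  sumBy (𝟙 op?) maps * sumBy (𝟙 (bounded? (suc k) ∩? (atZero? x ∩? op?))) maps
    ≡⟨ cong₂ _*_ (length-filter≡sumBy-𝟙 op? maps)
                 (Ω-delete≡sumBy-bounded-atZero _≺_ x _≺?_ x-min (s≤s⁻¹ k≤t)) ⟨
  Ω _≺_ _≺?_ (suc t) * Ω P∖x P∖x? (suc k)
    ≡⟨ *-comm (Ω _≺_ _≺?_ (suc t)) _ ⟩
  Ω P∖x P∖x? (suc k) * Ω _≺_ _≺?_ (suc t) ∎
  where
  open ≤-Reasoning
  P∖x = delete x _≺_
  P∖x? = delete? x _≺_ _≺?_
  maps = allMaps (suc m) (suc t)
  op? = orderPreserving? {t = suc t} _≺_ _≺?_
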